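{- Let $\mathcal{F}$ be a set of $c$-colored graphs such that each colored neighborhood class of every $F\in\mathcal{F}$ has size one. Let $G$ be an edge-colored graph, let $K$ be a colored neighborhood class of $G$, and let $S$ be a set of edges such that $G-S$ has no induced subgraph isomorphic to any $F\in\mathcal{F}$. Then there exists a set of edges $S'$ with $|S'|\leq|S|$ such that (a) $S'$ is consistent with $K$; (b) $G-S'$ is $F$-free for every $F\in\mathcal{F}$; (c) for each edge $e\notin E(K)\cup E(K,N(K))$, $e\in S'$ if and only if $e\in S$; (d) for every class $K'\in\mathcal{N}(K)$, if $S$ is consistent with $K'$ then $S'$ is consistent with $K'$.
   Context: Edge-colored graph: $E=E_1\sqcup\dots\sqcup E_c$. $N^i(v)=\{u:\{u,v\}\in E_i\}$, $N^i[v]=N^i(v)\cup\{v\}$. Vertices $u\sim v$ if either $N^i[u]=N^i[v]$ for some color $i$ and $N^j(u)=N^j(v)$ for all other colors $j$, or $N^j(u)=N^j(v)$ for all colors $j$; the equivalence classes of $\sim$ are the colored neighborhood classes. For vertex sets $A,B$, $E(A,B)$ is the set of edges with one endpoint in $A$ and one in $B$, and $E(A)=E(A,A)$. For a class $K$, $N(K)$ is the set of vertices outside $K$ adjacent to some vertex of $K$; $N(K)$ is a union of colored neighborhood classes of $G$, and $\mathcal{N}(K)$ denotes the set of these classes. An edge set $S$ is consistent with $K$ if for every $v\in N(K)$ either $E(\{v\},K)\subseteq S$ or $E(\{v\},K)\cap S=\emptyset$. Isomorphism preserves adjacency and edge colors; $G$ is $F$-free if no induced subgraph of $G$ is isomorphic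 to $F$. -}

module Defs where

open import Data.Nat using (ℕ; zero; suc; _<ᵇ_)
open import Data.Fin using (Fin; toℕ)
open import Data.List using (List; map; allFin)
open import Data.Nat.ListAction using (sum)
open import Data.Maybe using (Maybe; just; nothing)
open import Data.Bool using (Bool; true; false; if_then_else_; _∧_)
open import Data.Product using (Σ; Σ-syntax; _×_)
open import Data.Sum using (_⊎_)
open import Relation.Binary.PropositionalEquality using (_≡_; _≢_)
open import Relation.Nullary using (¬_)
open import Function.Bundles using (_⇔_)
open import Function.Definitions using (Injective)

-- A colouring of the pairs of vertices Fin n with c colours:
-- col u v ≡ just i  means {u,v} is an edge of colour i; nothing = non-edge.
Coloring : ℕ → ℕ → Set
Coloring c n = Fin n → Fin n → Maybe (Fin c)

record Graph (c n : ℕ) : Set where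
  field
    col    : Coloring c n
    sym    : ∀ u v → col u v ≡ col v u
    irrefl : ∀ v → col v v ≡ nothing
open Graph public

Adj : ∀ {c n} → Coloring c n → Fin n → Fin n → Set
Adj col u v = col u v ≢ nothing

SameOpen : ∀ {c n} → Coloring c n → Fin c → Fin n → Fin n → Set
SameOpen col i u v = ∀ w → (col u w ≡ just i) ⇔ (col v w ≡ just i)

SameClosed : ∀ {c n} → Coloring c n → Fin c → Fin n → Fin n → Set
SameClosed col i u v =
  ∀ w → (w ≡ u ⊎ col u w ≡ just i) ⇔ (w ≡ v ⊎ col v w ≡ just i)

Sim : ∀ {c n} → Coloring c n → Fin n → Fin n → Set
Sim {c} col u v =
  (Σ[ i ∈ Fin c ] (SameClosed col i u v × (∀ j → j ≢ i → SameOpen col j u v)))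
  ⊎ (∀ j → SameOpen col j u v)

ClassOf : ∀ {c n} → Graph c n → Fin n → Fin n → Set
ClassOf G v u = Sim (col G) u v

ClassesTrivial : ∀ {c m} → Graph c m → Set
ClassesTrivial F = ∀ a b → Sim (col F) a b → a ≡ b

record EdgeSet {c n : ℕ} (G : Graph c n) : Set where
  field
    mem  : Fin n → Fin n → Bool
    symm : ∀ u v → mem u v ≡ mem v u
    sub  : ∀ u v → mem u v ≡ true → Adj (col G) u v
open EdgeSet public

card : ∀ {c n} {G : Graph c n} → EdgeSet G → ℕ
card {n = n} S =
  sum (map (λ u → sum (map (λ v → if (toℕ u <ᵇ toℕ v) ∧ mem S u v then 1 else 0)
                             (allFin n)))
           (allFin n))

delete : ∀ {c n} (G : Graph c n) → EdgeSet G → Coloring c n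
delete G S u v = if mem S u v then nothing else col G u v

EmbedsInduced : ∀ {c m n} → Graph c m → Coloring c n → Set
EmbedsInduced {m = m} {n = n} F colH =
  Σ[ f ∈ (Fin m → Fin n) ] (Injective _≡_ _≡_ f × (∀ a b → colH (f a) (f b) ≡ col F a b))

Free : ∀ {c m n} → Graph c m → Coloring c n → Set
Free F colH = ¬ EmbedsInduced F colH

Family : ℕ → Set₁
Family c = ∀ {m} → Graph c m → Set

FamilyFree : ∀ {c n} → Family c → Coloring c n → Set
FamilyFree 𝓕 colH = ∀ {m} (F : Graph _ m) → 𝓕 F → Free F colH

InN : ∀ {c n} → Graph c n → (Fin n → Set) → Fin n → Set
InN G K w = ¬ K w × Σ[ u ∈ Fin _ ] (K u × Adj (col G) u w)

Consistent : ∀ {c n} (G : Graph c n) → EdgeSet G → (Fin n → Set) → Set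
Consistent G S K =
  ∀ w → InN G K w →
    (∀ u → K u → Adj (col G) u w → mem S u w ≡ true)
    ⊎ (∀ u → K u → Adj (col G) u w → mem S u w ≡ false)

module Submission where

-- The vertices of the class K of v are exactly the twins of v (they see every third vertex in
-- the same colour), so they are interchangeable. Choose u* ∈ K with the fewest S-edges from u*
-- to outside K, and let S′ be S pulled back along the map collapsing K onto u*, deleting nothing
-- inside K: every vertex of K then loses exactly the edges u* loses towards N(K), and S′ agrees
-- with S away from K. An induced copy of some F ∈ 𝓕 in G − S′ meets K at most once, since two of
-- its vertices in K would be twins in F; so collapsing it gives an induced copy in G − S.
-- Counting ordered pairs, |S′| ≤ |S| follows from the choice of u*.

open import Defs renaming (sym to col-sym)

open import Data.Bool using (Bool; true; false; if_then_else_; _∧_; _∨_; not)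
open import Data.Bool.Properties using (T-≡; ¬-not)
open import Data.Fin using (Fin; toℕ; _≟_) renaming (zero to fzero; suc to fsuc)
open import Data.Fin.Properties using (all?; <-cmp)
open import Data.List using (map; allFin; tabulate; filter)
open import Data.List.Extrema.Nat using (argmin; argmin-all; f[argmin]≤f[xs])
open import Data.List.Membership.Propositional.Properties using (∈-filter⁺; ∈-allFin)
open import Data.List.Properties using (map-tabulate; map-cong)
open import Data.List.Relation.Unary.All using (lookup)
open import Data.List.Relation.Unary.All.Properties using (all-filter)
open import Data.Maybe using (Maybe; just; nothing)
open import Data.Maybe.Properties using (just-injective)
import Data.Maybe.Properties as Maybe
open import Data.Nat using (ℕ; zero; suc; _≤_; _<_; _+_; _<ᵇ_; z≤n)
import Data.Nat.ListAction as ListAction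
open import Data.Nat.Properties
  using (+-0-commutativeMonoid; +-mono-≤; +-mono-<; +-identityʳ; m≤n+m; ≤-reflexive;
         ≮⇒≥; <⇒≱; <ᵇ⇒<; <⇒<ᵇ; module ≤-Reasoning)
open import Data.Product using (Σ-syntax; _×_; _,_; proj₁; proj₂; uncurry)
open import Data.Sum using (_⊎_; inj₁; inj₂; [_,_]′; fromInj₂)
import Data.Sum as Sum
open import Function using (_∘_; id; flip)
open import Function.Bundles using (_⇔_; mk⇔; Equivalence)
open import Relation.Binary.Definitions using (tri<; tri≈; tri>)
open import Relation.Binary.PropositionalEquality
open import Relation.Nullary using (¬_; Dec; yes; no; does; contradiction)
open import Relation.Nullary.Decidable using (toSum; map′; ¬?; _→-dec_; _×-dec_)

open import Algebra.Properties.CommutativeMonoid.Sum +-0-commutativeMonoid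
  using (sum; sum-syntax; ∑-distrib-+; ∑-comm; sum-cong-≗; sum-replicate-zero)

private
  variable
    c n : ℕ

Twin : Coloring c n → Fin n → Fin n → Set
Twin col x y = ∀ z → z ≢ x → z ≢ y → col x z ≡ col y z

twin? : (col : Coloring c n) → ∀ x y → Dec (Twin col x y)
twin? col x y =
  all? λ z → ¬? (z ≟ x) →-dec ¬? (z ≟ y) →-dec Maybe.≡-dec _≟_ (col x z) (col y z)

Twin-refl : ∀ {col : Coloring c n} {x} → Twin col x x
Twin-refl _ _ _ = refl

Twin-sym : ∀ {col : Coloring c n} {x y} → Twin col x y → Twin col y x
Twin-sym t z z≢y z≢x = sym (t z z≢x z≢y)

Twin-trans : (G : Graph c n) → ∀ {x y z} → Twin (col G) x y → Twin (col G) y z → Twin (col G) x z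
Twin-trans G {x} {y} {z} txy tyz w w≢x w≢z with w ≟ y | x ≟ z
... | no w≢y | _ = trans (txy w w≢x w≢y) (tyz w w≢y w≢z)
... | yes refl | yes refl = refl
... | yes refl | no x≢z = begin
  col G x w ≡⟨ col-sym G x w ⟩
  col G w x ≡⟨ tyz x (w≢x ∘ sym) x≢z ⟩
  col G z x ≡⟨ col-sym G z x ⟩
  col G x z ≡⟨ txy z (x≢z ∘ sym) (w≢z ∘ sym) ⟩
  col G w z ≡⟨ col-sym G w z ⟩
  col G z w ∎
  where open ≡-Reasoning

just-⇔⇒≡ : ∀ {x y : Maybe (Fin c)} → (∀ j → (x ≡ just j) ⇔ (y ≡ just j)) → x ≡ y
just-⇔⇒≡ {x = just i} same = sym (Equivalence.to (same i) refl)
just-⇔⇒≡ {x = nothing} {just j} same with () ← Equivalence.from (same j) refl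
just-⇔⇒≡ {x = nothing} {nothing} _ = refl

Sim⇒Twin : ∀ {col : Coloring c n} {x y} → Sim col x y → Twin col x y
Sim⇒Twin (inj₂ same) z _ _ = just-⇔⇒≡ λ j → same j z
Sim⇒Twin {col = col} {x} {y} (inj₁ (i , closed , same)) z z≢x z≢y = just-⇔⇒≡ sameAt
  where
  sameAt : ∀ j → (col x z ≡ just j) ⇔ (col y z ≡ just j)
  sameAt j with j ≟ i
  ... | no j≢i = same j j≢i z
  ... | yes refl = mk⇔
    (fromInj₂ (λ e → contradiction e z≢y) ∘ Equivalence.to (closed z) ∘ inj₂)
    (fromInj₂ (λ e → contradiction e z≢x) ∘ Equivalence.from (closed z) ∘ inj₂)

module _ (G : Graph c n) {a b : Fin n} (t : Twin (col G) a b) where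

  twin-colour : ∀ {j w} → col G a w ≡ just j
    → col G b w ≡ just j ⊎ (w ≡ b × col G a b ≡ just j)
  twin-colour {w = w} e with w ≟ a | w ≟ b
  ... | yes refl | _ with () ← trans (sym (irrefl G a)) e
  ... | no _ | yes refl = inj₂ (refl , e)
  ... | no w≢a | no w≢b = inj₁ (trans (sym (t w w≢a w≢b)) e)

  twin-open : ∀ {j w} → col G a b ≢ just j → col G a w ≡ just j → col G b w ≡ just j
  twin-open ab≢j e = [ id , (λ (_ , e′) → contradiction e′ ab≢j) ]′ (twin-colour e)

  twin-closed : ∀ {i w} → col G a b ≡ just i
    → w ≡ a ⊎ col G a w ≡ just i → w ≡ b ⊎ col G b w ≡ just i
  twin-closed e (inj₁ refl) = inj₂ (trans (col-sym G b a) e)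
  twin-closed e (inj₂ e′) = [ inj₂ , inj₁ ∘ proj₁ ]′ (twin-colour e′)

Twin⇒SameOpen : (G : Graph c n) → ∀ {a b j} → Twin (col G) a b → col G a b ≢ just j
  → SameOpen (col G) j a b
Twin⇒SameOpen G {a} t ab≢j w =
  mk⇔ (twin-open G t ab≢j) (twin-open G (Twin-sym t) (ab≢j ∘ trans (col-sym G a _)))

Twin⇒SameClosed : (G : Graph c n) → ∀ {a b i} → Twin (col G) a b → col G a b ≡ just i
  → SameClosed (col G) i a b
Twin⇒SameClosed G {b = b} t ab≡i w =
  mk⇔ (twin-closed G t ab≡i) (twin-closed G (Twin-sym t) (trans (col-sym G b _) ab≡i))

Twin⇒Sim : (G : Graph c n) → ∀ {a b} → Twin (col G) a b → Sim (col G) a b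
Twin⇒Sim G {a} {b} t with col G a b in ab≡
... | nothing = inj₂ λ j →
  Twin⇒SameOpen G t λ ab≡j → contradiction (trans (sym ab≡) ab≡j) λ ()
... | just i = inj₁ (i , Twin⇒SameClosed G t ab≡ , λ j j≢i →
  Twin⇒SameOpen G t (j≢i ∘ sym ∘ just-injective ∘ trans (sym ab≡)))

Sim-sym : (G : Graph c n) → ∀ {x y} → Sim (col G) x y → Sim (col G) y x
Sim-sym G = Twin⇒Sim G ∘ Twin-sym ∘ Sim⇒Twin

Sim-trans : (G : Graph c n) → ∀ {x y z} → Sim (col G) x y → Sim (col G) y z → Sim (col G) x z
Sim-trans G s s′ = Twin⇒Sim G (Twin-trans G (Sim⇒Twin s) (Sim⇒Twin s′))

sim? : (G : Graph c n) → ∀ x y → Dec (Sim (col G) x y)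
sim? G x y = map′ (Twin⇒Sim G) Sim⇒Twin (twin? (col G) x y)

𝟙 : Bool → ℕ
𝟙 b = if b then 1 else 0

sum-tabulate : ∀ {n} (f : Fin n → ℕ) → ListAction.sum (tabulate f) ≡ ∑[ i < n ] f i
sum-tabulate {zero} f = refl
sum-tabulate {suc n} f = cong (f fzero +_) (sum-tabulate (f ∘ fsuc))

sum-map-allFin : ∀ {n} (f : Fin n → ℕ) → ListAction.sum (map f (allFin n)) ≡ ∑[ i < n ] f i
sum-map-allFin f = trans (cong ListAction.sum (map-tabulate id f)) (sum-tabulate f)

∑-mono-≤ : ∀ {n} {f g : Fin n → ℕ} → (∀ i → f i ≤ g i)
  → ∑[ i < n ] f i ≤ ∑[ i < n ] g i
∑-mono-≤ {zero} _ = z≤n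
∑-mono-≤ {suc n} f≤g = +-mono-≤ (f≤g fzero) (∑-mono-≤ (f≤g ∘ fsuc))

∑∑-distrib-+ : ∀ {n} (f g : Fin n → Fin n → ℕ)
  → ∑[ a < n ] ∑[ b < n ] (f a b + g a b)
    ≡ ∑[ a < n ] ∑[ b < n ] f a b + ∑[ a < n ] ∑[ b < n ] g a b
∑∑-distrib-+ {n} f g = trans (sum-cong-≗ {n} λ a → ∑-distrib-+ (f a) (g a))
  (∑-distrib-+ (λ a → ∑[ b < n ] f a b) (λ a → ∑[ b < n ] g a b))

pairs : (Fin n → Fin n → Bool) → ℕ
pairs {n} r = ∑[ a < n ] ∑[ b < n ] 𝟙 (r a b)

card≡∑∑ : ∀ {G : Graph c n} (T : EdgeSet G)
  → card T ≡ ∑[ a < n ] ∑[ b < n ] 𝟙 ((toℕ a <ᵇ toℕ b) ∧ mem T a b)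
card≡∑∑ {n = n} T =
  trans (cong ListAction.sum (map-cong (λ a → sum-map-allFin (row a)) (allFin n)))
        (sum-map-allFin λ a → ∑[ b < n ] row a b)
  where
  row : Fin n → Fin n → ℕ
  row a b = 𝟙 ((toℕ a <ᵇ toℕ b) ∧ mem T a b)

<ᵇ≡true : ∀ {m n} → m < n → (m <ᵇ n) ≡ true
<ᵇ≡true m<n = Equivalence.to T-≡ (<⇒<ᵇ m<n)

<ᵇ≡false : ∀ {m n} → ¬ m < n → (m <ᵇ n) ≡ false
<ᵇ≡false {m} {n} m≮n = ¬-not λ e → m≮n (<ᵇ⇒< m n (Equivalence.from T-≡ e))

m+m≤n+n⇒m≤n : ∀ {m n} → m + m ≤ n + n → m ≤ n
m+m≤n+n⇒m≤n le = ≮⇒≥ λ n<m → <⇒≱ (+-mono-< n<m n<m) le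

mem-irrefl : ∀ {G : Graph c n} (T : EdgeSet G) x → mem T x x ≡ false
mem-irrefl {G = G} T x = ¬-not λ e → sub T x x e (irrefl G x)

card+card≡pairs : ∀ {G : Graph c n} (T : EdgeSet G) → card T + card T ≡ pairs (mem T)
card+card≡pairs {n = n} T = begin
  card T + card T
    ≡⟨ cong₂ _+_ (card≡∑∑ T) (trans (card≡∑∑ T) (∑-comm below)) ⟩
  ∑[ a < n ] ∑[ b < n ] below a b + ∑[ a < n ] ∑[ b < n ] below b a
    ≡⟨ sym (∑∑-distrib-+ below (flip below)) ⟩
  ∑[ a < n ] ∑[ b < n ] (below a b + below b a)
    ≡⟨ sum-cong-≗ (λ a → sum-cong-≗ (below-+-above a)) ⟩
  pairs (mem T) ∎
  where
  open ≡-Reasoning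
  below : Fin n → Fin n → ℕ
  below a b = 𝟙 ((toℕ a <ᵇ toℕ b) ∧ mem T a b)
  below-+-above : ∀ a b → below a b + below b a ≡ 𝟙 (mem T a b)
  below-+-above a b with <-cmp a b
  ... | tri< a<b _ b≮a rewrite <ᵇ≡true a<b | <ᵇ≡false b≮a = +-identityʳ _
  ... | tri> a≮b _ b<a rewrite <ᵇ≡false a≮b | <ᵇ≡true b<a = cong 𝟙 (symm T b a)
  ... | tri≈ a≮a refl _ rewrite <ᵇ≡false a≮a | mem-irrefl T a = refl

delete-irrefl : (G : Graph c n) (T : EdgeSet G) → ∀ x → delete G T x x ≡ nothing
delete-irrefl G T x = trans (cong (λ s → if s then nothing else col G x x) (mem-irrefl T x)) (irrefl G x)

Twin-reflect : ∀ {m} {F : Graph c m} {H : Coloring c n} → ((f , _ , _) : EmbedsInduced F H)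
  → ∀ {a b} → Twin H (f a) (f b) → Twin (col F) a b
Twin-reflect (f , f-inj , f-pres) {a} {b} t z z≢a z≢b =
  trans (sym (f-pres a z)) (trans (t (f z) (z≢a ∘ f-inj) (z≢b ∘ f-inj)) (f-pres b z))

Consistent-transfer : ∀ {G : Graph c n} {T T′ : EdgeSet G} {L : Fin n → Set}
  → (∀ z → InN G L z → Σ[ z′ ∈ Fin n ] (InN G L z′
       × (∀ {u} → L u → Adj (col G) u z → Adj (col G) u z′)
       × (∀ {u} → L u → mem T′ u z ≡ mem T u z′)))
  → Consistent G T L → Consistent G T′ L
Consistent-transfer {G = G} {T} {T′} {L} redirect T-cons z z∈N
  with z′ , z′∈N , adj-move , mem-move ← redirect z z∈N =
  Sum.map pull pull (T-cons z′ z′∈N)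
  where
  pull : ∀ {β} → (∀ u → L u → Adj (col G) u z′ → mem T u z′ ≡ β)
               → ∀ u → L u → Adj (col G) u z → mem T′ u z ≡ β
  pull h u u∈L adj = trans (mem-move u∈L) (h u u∈L (adj-move u∈L adj))

module SplitPairs {n} {P : Fin n → Set} (P? : ∀ x → Dec (P x)) where

  inner cross outer : (Fin n → Fin n → Bool) → Fin n → Fin n → ℕ
  inner r a b = if does (P? a) ∧ does (P? b) then 𝟙 (r a b) else 0
  cross r a b = if does (P? a) ∧ not (does (P? b)) then 𝟙 (r a b) else 0
  outer r a b = if does (P? a) ∨ does (P? b) then 0 else 𝟙 (r a b)

  crossRow : (Fin n → Fin n → Bool) → Fin n → ℕ
  crossRow r a = ∑[ b < n ] cross r a b

  inside crossing outside : (Fin n → Fin n → Bool) → ℕ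
  inside r = ∑[ a < n ] ∑[ b < n ] inner r a b
  crossing r = ∑[ a < n ] crossRow r a
  outside r = ∑[ a < n ] ∑[ b < n ] outer r a b

  crossRow-shift : ∀ {r r′ a a′} → P a → P a′ → (∀ {b} → ¬ P b → r a b ≡ r′ a′ b)
    → crossRow r a ≡ crossRow r′ a′
  crossRow-shift {r} {r′} {a} {a′} pa pa′ eq = sum-cong-≗ shift
    where
    shift : ∀ b → cross r a b ≡ cross r′ a′ b
    shift b with P? a | P? a′ | P? b
    ... | no ¬pa | _       | _      = contradiction pa ¬pa
    ... | yes _  | no ¬pa′ | _      = contradiction pa′ ¬pa′
    ... | yes _  | yes _   | yes _  = refl
    ... | yes _  | yes _   | no ¬pb = cong 𝟙 (eq ¬pb)

  crossRow-∉ : ∀ {r a} → ¬ P a → crossRow r a ≡ 0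
  crossRow-∉ {a = a} ¬pa with P? a
  ... | yes pa = contradiction pa ¬pa
  ... | no _   = sum-replicate-zero n

  outer-cong : ∀ {r r′ a b} → (¬ P a → ¬ P b → r a b ≡ r′ a b)
    → outer r a b ≡ outer r′ a b
  outer-cong {a = a} {b} eq with P? a | P? b
  ... | yes _  | _      = refl
  ... | no _   | yes _  = refl
  ... | no ¬pa | no ¬pb = cong 𝟙 (eq ¬pa ¬pb)

  module _ {r : Fin n → Fin n → Bool} (r-sym : ∀ a b → r a b ≡ r b a) where

    blocks : ∀ a b → inner r a b + (cross r a b + cross r b a + outer r a b) ≡ 𝟙 (r a b)
    blocks a b with P? a | P? b
    ... | yes _ | yes _ = +-identityʳ _
    ... | yes _ | no _  = trans (+-identityʳ _) (+-identityʳ _)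
    ... | no _  | yes _ = trans (+-identityʳ _) (cong 𝟙 (r-sym b a))
    ... | no _  | no _  = refl

    pairs-blocks : pairs r ≡ inside r + (crossing r + crossing r + outside r)
    pairs-blocks = begin
      pairs r
        ≡⟨ sum-cong-≗ (λ a → sum-cong-≗ (blocks a)) ⟨
      ∑[ a < n ] ∑[ b < n ] (inner r a b + (cross r a b + cross r b a + outer r a b))
        ≡⟨ ∑∑-distrib-+ (inner r) (λ a b → cross r a b + cross r b a + outer r a b) ⟩
      inside r + ∑[ a < n ] ∑[ b < n ] (cross r a b + cross r b a + outer r a b)
        ≡⟨ cong (inside r +_) (∑∑-distrib-+ (λ a b → cross r a b + cross r b a) (outer r)) ⟩
      inside r + (∑[ a < n ] ∑[ b < n ] (cross r a b + cross r b a) + outside r)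
        ≡⟨ cong (λ x → inside r + (x + outside r)) (∑∑-distrib-+ (cross r) (flip (cross r))) ⟩
      inside r + (crossing r + ∑[ a < n ] ∑[ b < n ] cross r b a + outside r)
        ≡⟨ cong (λ x → inside r + (crossing r + x + outside r)) (∑-comm (cross r)) ⟨
      inside r + (crossing r + crossing r + outside r) ∎
      where open ≡-Reasoning

    pairs-≥ : crossing r + crossing r + outside r ≤ pairs r
    pairs-≥ = subst (crossing r + crossing r + outside r ≤_) (sym pairs-blocks) (m≤n+m _ (inside r))

    pairs-≡ : (∀ {a b} → P a → P b → r a b ≡ false)
      → pairs r ≡ crossing r + crossing r + outside r
    pairs-≡ r-vanishes = trans pairs-blocks (cong (_+ (crossing r + crossing r + outside r)) inside≡0)
      where
      inner≡0 : ∀ a b → inner r a b ≡ 0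
      inner≡0 a b with P? a | P? b
      ... | yes pa | yes pb = cong 𝟙 (r-vanishes pa pb)
      ... | yes _  | no _   = refl
      ... | no _   | _      = refl
      inside≡0 : inside r ≡ 0
      inside≡0 = trans (sum-cong-≗ λ a → trans (sum-cong-≗ (inner≡0 a)) (sum-replicate-zero n))
                        (sum-replicate-zero n)

module Collapse (G : Graph c n) (v : Fin n) (S : EdgeSet G) where

  K : Fin n → Set
  K = ClassOf G v

  K? : ∀ x → Dec (K x)
  K? x = sim? G x v

  open SplitPairs K?

  K-twins : ∀ {x y} → K x → K y → Twin (col G) x y
  K-twins x∈K y∈K = Twin-trans G (Sim⇒Twin x∈K) (Twin-sym (Sim⇒Twin y∈K))

  ∉-≢ : ∀ {x y} → K x → ¬ K y → y ≢ x
  ∉-≢ x∈K y∉K refl = y∉K x∈K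

  u* : Fin n
  u* = argmin (crossRow (mem S)) v (filter K? (allFin n))

  u*∈K : K u*
  u*∈K = argmin-all (crossRow (mem S)) (Twin⇒Sim G (Twin-refl {col = col G}))
    (all-filter K? (allFin n))

  u*-minimal : ∀ {x} → K x → crossRow (mem S) u* ≤ crossRow (mem S) x
  u*-minimal {x} x∈K =
    lookup (f[argmin]≤f[xs] v (filter K? (allFin n))) (∈-filter⁺ K? (∈-allFin x) x∈K)

  collapse : Fin n → Fin n
  collapse x with K? x
  ... | yes _ = u*
  ... | no _  = x

  collapse-∈ : ∀ {x} → K x → collapse x ≡ u*
  collapse-∈ {x} x∈K with K? x
  ... | yes _ = refl
  ... | no x∉K = contradiction x∈K x∉K

  collapse-∉ : ∀ {x} → ¬ K x → collapse x ≡ x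
  collapse-∉ {x} x∉K with K? x
  ... | yes x∈K = contradiction x∈K x∉K
  ... | no _ = refl

  col-collapse : ∀ {a b} → ¬ (K a × K b) → col G (collapse a) (collapse b) ≡ col G a b
  col-collapse {a} {b} not-both with K? a | K? b
  ... | yes a∈K | yes b∈K = contradiction (a∈K , b∈K) not-both
  ... | yes a∈K | no b∉K  = K-twins u*∈K a∈K b (∉-≢ u*∈K b∉K) (∉-≢ a∈K b∉K)
  ... | no a∉K  | yes b∈K = begin
    col G a u* ≡⟨ col-sym G a u* ⟩
    col G u* a ≡⟨ K-twins u*∈K b∈K a (∉-≢ u*∈K a∉K) (∉-≢ b∈K a∉K) ⟩
    col G b a  ≡⟨ col-sym G b a ⟩
    col G a b  ∎
    where open ≡-Reasoning
  ... | no _    | no _    = refl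

  mem′ : Fin n → Fin n → Bool
  mem′ a b with K? a ×-dec K? b
  ... | yes _ = false
  ... | no _  = mem S (collapse a) (collapse b)

  mem′-both : ∀ {a b} → K a → K b → mem′ a b ≡ false
  mem′-both {a} {b} a∈K b∈K with K? a ×-dec K? b
  ... | yes _ = refl
  ... | no not-both = contradiction (a∈K , b∈K) not-both

  mem′-collapse : ∀ {a b} → ¬ (K a × K b) → mem′ a b ≡ mem S (collapse a) (collapse b)
  mem′-collapse {a} {b} not-both with K? a ×-dec K? b
  ... | yes both = contradiction both not-both
  ... | no _ = refl

  mem′-sym : ∀ a b → mem′ a b ≡ mem′ b a
  mem′-sym a b with K? a ×-dec K? b | K? b ×-dec K? a
  ... | yes _ | yes _ = refl
  ... | yes (a∈K , b∈K) | no not-both = contradiction (b∈K , a∈K) not-both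
  ... | no not-both | yes (b∈K , a∈K) = contradiction (a∈K , b∈K) not-both
  ... | no _ | no _ = symm S _ _

  mem′-sub : ∀ a b → mem′ a b ≡ true → Adj (col G) a b
  mem′-sub a b e with K? a ×-dec K? b
  ... | no not-both = sub S _ _ e ∘ trans (col-collapse not-both)

  S′ : EdgeSet G
  S′ = record { mem = mem′ ; symm = mem′-sym ; sub = mem′-sub }

  mem′-∈∉ : ∀ {a b} → K a → ¬ K b → mem′ a b ≡ mem S u* b
  mem′-∈∉ a∈K b∉K =
    trans (mem′-collapse (b∉K ∘ proj₂)) (cong₂ (mem S) (collapse-∈ a∈K) (collapse-∉ b∉K))

  col-collapseʳ : ∀ {a b} → ¬ K a → col G a (collapse b) ≡ col G a b
  col-collapseʳ {a} {b} a∉K =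
    trans (cong (λ x → col G x (collapse b)) (sym (collapse-∉ a∉K))) (col-collapse (a∉K ∘ proj₁))

  mem′-collapseʳ : ∀ {a b} → ¬ K a → mem′ a b ≡ mem S a (collapse b)
  mem′-collapseʳ {b = b} a∉K =
    trans (mem′-collapse (a∉K ∘ proj₁)) (cong (λ x → mem S x (collapse b)) (collapse-∉ a∉K))

  mem′-∉∉ : ∀ {a b} → ¬ K a → ¬ K b → mem′ a b ≡ mem S a b
  mem′-∉∉ {a} a∉K b∉K = trans (mem′-collapseʳ a∉K) (cong (mem S a) (collapse-∉ b∉K))

  -- Case splits on membership in K go through toSum: a 'with K? a' would also abstract the
  -- occurrence of K? a inside mem′, and the mem′ lemmas would no longer apply.
  crossRow-S′≤ : ∀ a → crossRow mem′ a ≤ crossRow (mem S) a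
  crossRow-S′≤ a with toSum (K? a)
  ... | inj₁ a∈K = begin
    crossRow mem′ a      ≡⟨ crossRow-shift {r = mem′} {mem S} a∈K u*∈K (mem′-∈∉ a∈K) ⟩
    crossRow (mem S) u*  ≤⟨ u*-minimal a∈K ⟩
    crossRow (mem S) a   ∎
    where open ≤-Reasoning
  ... | inj₂ a∉K =
    ≤-reflexive (trans (crossRow-∉ {r = mem′} a∉K) (sym (crossRow-∉ {r = mem S} a∉K)))

  card-S′≤card-S : card S′ ≤ card S
  card-S′≤card-S = m+m≤n+n⇒m≤n (begin
    card S′ + card S′
      ≡⟨ card+card≡pairs S′ ⟩
    pairs mem′
      ≡⟨ pairs-≡ {r = mem′} mem′-sym mem′-both ⟩
    crossing mem′ + crossing mem′ + outside mem′
      ≤⟨ +-mono-≤ (+-mono-≤ crossing≤ crossing≤) (≤-reflexive outside≡) ⟩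
    crossing (mem S) + crossing (mem S) + outside (mem S)
      ≤⟨ pairs-≥ (symm S) ⟩
    pairs (mem S)
      ≡⟨ card+card≡pairs S ⟨
    card S + card S ∎)
    where
    open ≤-Reasoning
    crossing≤ : crossing mem′ ≤ crossing (mem S)
    crossing≤ = ∑-mono-≤ {n} crossRow-S′≤
    outside≡ : outside mem′ ≡ outside (mem S)
    outside≡ = sum-cong-≗ {n} λ _ → sum-cong-≗ {n} λ _ → outer-cong {r = mem′} {mem S} mem′-∉∉

  delete-collapse : ∀ {a b} → ¬ (K a × K b)
    → delete G S (collapse a) (collapse b) ≡ delete G S′ a b
  delete-collapse not-both =
    cong₂ (λ s c → if s then nothing else c) (sym (mem′-collapse not-both)) (col-collapse not-both)

  delete-both : ∀ {a b} → K a → K b → delete G S′ a b ≡ col G a b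
  delete-both {a} {b} a∈K b∈K = cong (λ s → if s then nothing else col G a b) (mem′-both a∈K b∈K)

  K-twins-S′ : ∀ {x y} → K x → K y → Twin (delete G S′) x y
  K-twins-S′ {x} {y} x∈K y∈K z z≢x z≢y with toSum (K? z)
  ... | inj₁ z∈K = begin
    delete G S′ x z  ≡⟨ delete-both x∈K z∈K ⟩
    col G x z        ≡⟨ K-twins x∈K y∈K z z≢x z≢y ⟩
    col G y z        ≡⟨ delete-both y∈K z∈K ⟨
    delete G S′ y z  ∎
    where open ≡-Reasoning
  ... | inj₂ z∉K = begin
    delete G S′ x z                       ≡⟨ delete-collapse (z∉K ∘ proj₂) ⟨
    delete G S (collapse x) (collapse z)  ≡⟨ cong (λ w → delete G S w (collapse z)) x~y ⟩
    delete G S (collapse y) (collapse z)  ≡⟨ delete-collapse (z∉K ∘ proj₂) ⟩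
    delete G S′ y z                       ∎
    where
    open ≡-Reasoning
    x~y = trans (collapse-∈ x∈K) (sym (collapse-∈ y∈K))

  collapse-injective : ∀ {x y} → collapse x ≡ collapse y → (K x × K y) ⊎ x ≡ y
  collapse-injective {x} {y} e with K? x | K? y
  ... | yes x∈K | yes y∈K = inj₁ (x∈K , y∈K)
  ... | yes _   | no y∉K  = contradiction (subst K e u*∈K) y∉K
  ... | no x∉K  | yes _   = contradiction (subst K (sym e) u*∈K) x∉K
  ... | no _    | no _    = inj₂ e

  collapse-embeds : ∀ {m} (F : Graph c m) → ClassesTrivial F
    → EmbedsInduced F (delete G S′) → EmbedsInduced F (delete G S)
  collapse-embeds F F-trivial emb@(f , f-inj , f-pres) = collapse ∘ f , g-inj , g-pres
    where
    merged : ∀ {a b} → K (f a) → K (f b) → a ≡ b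
    merged {a} {b} fa∈K fb∈K = F-trivial a b
      (Twin⇒Sim F (Twin-reflect {F = F} {H = delete G S′} emb (K-twins-S′ fa∈K fb∈K)))
    g-inj : ∀ {a b} → collapse (f a) ≡ collapse (f b) → a ≡ b
    g-inj e = [ uncurry merged , f-inj ]′ (collapse-injective e)
    g-pres : ∀ a b → delete G S (collapse (f a)) (collapse (f b)) ≡ col F a b
    g-pres a b with a ≟ b
    ... | yes refl = trans (delete-irrefl G S _) (sym (irrefl F a))
    ... | no a≢b   = trans (delete-collapse (a≢b ∘ uncurry merged)) (f-pres a b)

  S′-consistent : Consistent G S′ K
  S′-consistent w (w∉K , _) with mem S u* w in u*w
  ... | true  = inj₁ λ u u∈K _ → trans (mem′-∈∉ u∈K w∉K) u*w
  ... | false = inj₂ λ u u∈K _ → trans (mem′-∈∉ u∈K w∉K) u*w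

  S′-agrees : ∀ a b → Adj (col G) a b
    → ¬ (K a × K b) → ¬ (K a × InN G K b) → ¬ (K b × InN G K a)
    → mem S′ a b ≡ mem S a b
  S′-agrees a b adj not-KK not-KN not-NK = mem′-∉∉ a∉K b∉K
    where
    a∉K : ¬ K a
    a∉K a∈K = [ (λ b∈K → not-KK (a∈K , b∈K))
              , (λ b∉K → not-KN (a∈K , b∉K , a , a∈K , adj)) ]′
      (toSum (K? b))
    b∉K : ¬ K b
    b∉K b∈K = [ (λ a∈K → not-KK (a∈K , b∈K))
              , (λ a∉K → not-NK (b∈K , a∉K , b , b∈K , adj ∘ trans (col-sym G a b))) ]′
      (toSum (K? a))

  S′-preserves-consistency : ∀ w → InN G K w
    → Consistent G S (ClassOf G w) → Consistent G S′ (ClassOf G w)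
  S′-preserves-consistency w (w∉K , _) = Consistent-transfer {T = S} {S′} redirect
    where
    L = ClassOf G w
    L∌K : ∀ {u} → L u → ¬ K u
    L∌K u∈L u∈K = w∉K (Sim-trans G (Sim-sym G u∈L) u∈K)
    redirect : ∀ z → InN G L z → Σ[ z′ ∈ Fin n ] (InN G L z′
       × (∀ {u} → L u → Adj (col G) u z → Adj (col G) u z′)
       × (∀ {u} → L u → mem S′ u z ≡ mem S u z′))
    redirect z (z∉L , u₀ , u₀∈L , u₀z) =
      collapse z , (cz∉L , u₀ , u₀∈L , adj-move u₀∈L u₀z) , adj-move , mem-move
      where
      adj-move : ∀ {u} → L u → Adj (col G) u z → Adj (col G) u (collapse z)
      adj-move u∈L uz = uz ∘ trans (sym (col-collapseʳ (L∌K u∈L)))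
      mem-move : ∀ {u} → L u → mem S′ u z ≡ mem S u (collapse z)
      mem-move u∈L = mem′-collapseʳ (L∌K u∈L)
      cz∉L : ¬ L (collapse z)
      cz∉L cz∈L = [ (λ z∈K → L∌K cz∈L (subst K (sym (collapse-∈ z∈K)) u*∈K))
                  , (λ z∉K → z∉L (subst L (collapse-∉ z∉K) cz∈L)) ]′ (toSum (K? z))

lemma16 : ∀ {c n} (𝓕 : Family c)
    → (∀ {m} (F : Graph c m) → 𝓕 F → ClassesTrivial F)
    → (G : Graph c n) (v : Fin n) (S : EdgeSet G)
    → FamilyFree 𝓕 (delete G S)
    → Σ[ S′ ∈ EdgeSet G ]
        ( card S′ ≤ card S
        × Consistent G S′ (ClassOf G v)
        × FamilyFree 𝓕 (delete G S′)
        × (∀ a b → Adj (col G) a b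
             → ¬ (ClassOf G v a × ClassOf G v b)
             → ¬ (ClassOf G v a × InN G (ClassOf G v) b)
             → ¬ (ClassOf G v b × InN G (ClassOf G v) a)
             → mem S′ a b ≡ mem S a b)
        × (∀ w → InN G (ClassOf G v) w
             → Consistent G S (ClassOf G w)
             → Consistent G S′ (ClassOf G w)))
lemma16 𝓕 trivial G v S S-free =
  S′ , card-S′≤card-S , S′-consistent , S′-free , S′-agrees , S′-preserves-consistency
  where
  open Collapse G v S
  S′-free : FamilyFree 𝓕 (delete G S′)
  S′-free F F∈𝓕 = S-free F F∈𝓕 ∘ collapse-embeds F (trivial F F∈𝓕)
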